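{- Let $T$ be a well-totally dominated balanced tree of height 3, and let $T'$ be the subgraph of $T$ induced by $V_3\cup V_2$. Then $T'$ is a tree (i.e., $T'$ is connected).
   Context: A leaf is a vertex of degree 1; the height of a vertex is its minimum distance to a leaf; $V_k$ is the set of vertices of height $k$; the height of $T$ is the maximum height of a vertex. A tree is balanced if no two vertices of the same height are adjacent. A total dominating set is a set $S$ with $N(S)=V(T)$ ($N$ = union of open neighborhoods); $T$ is well-totally dominated if all its inclusion-minimal total dominating sets have the same size. -}

module Defs where

open import Data.Nat using (ℕ; zero; suc; _≤_)
open import Data.Bool using (Bool; true; false; if_then_else_)
open import Data.Fin using (Fin)
open import Data.Fin.Subset using (Subset; _∈_; _⊂_; ∣_∣)
open import Data.List using (List; []; _∷_; map; allFin)
open import Data.Nat.ListAction using (sum)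
open import Data.List.Relation.Unary.All using (All)
open import Data.List.Relation.Unary.Unique.Propositional using (Unique)
open import Data.Product using (Σ; ∃; _×_; _,_)
open import Data.Unit using (⊤)
open import Data.Empty using (⊥)
open import Relation.Binary.PropositionalEquality using (_≡_)
open import Relation.Nullary using (¬_)

record Graph (n : ℕ) : Set where
  field
    E      : Fin n → Fin n → Bool
    sym    : ∀ u v → E u v ≡ E v u
    irrefl : ∀ v → E v v ≡ false

module _ {n : ℕ} (G : Graph n) where
  open Graph G

  Adj : Fin n → Fin n → Set
  Adj u v = E u v ≡ true

  degree : Fin n → ℕ
  degree v = sum (map (λ w → if E v w then 1 else 0) (allFin n))

  IsLeaf : Fin n → Set
  IsLeaf v = degree v ≡ 1

  data Walk : Fin n → Fin n → ℕ → Set where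
    []  : ∀ {u} → Walk u u 0
    _∷_ : ∀ {u w v k} → Adj u w → Walk w v k → Walk u v (suc k)

  verts : ∀ {u v k} → Walk u v k → List (Fin n)
  verts ([] {u}) = u ∷ []
  verts (_∷_ {u} _ p) = u ∷ verts p

  HasHeight : Fin n → ℕ → Set
  HasHeight v k =
    (Σ (Fin n) λ l → IsLeaf l × Walk v l k) ×
    (∀ l j → IsLeaf l → Walk v l j → k ≤ j)

  ConnectedOn : (Fin n → Set) → Set
  ConnectedOn P = ∀ u v → P u → P v →
    Σ ℕ λ k → Σ (Walk u v k) λ p → All P (verts p)

  -- a cycle (at least 3 distinct vertices) inside the vertices satisfying P
  CycleOn : (Fin n → Set) → Set
  CycleOn P = Σ (Fin n) λ u → Σ (Fin n) λ v → Σ ℕ λ k →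
    Σ (Walk u v (suc (suc k))) λ p →
      Unique (verts p) × All P (verts p) × Adj v u

  IsTreeOn : (Fin n → Set) → Set
  IsTreeOn P = ConnectedOn P × ¬ CycleOn P

  IsTree : Set
  IsTree = IsTreeOn (λ _ → ⊤)

  TreeHeight : ℕ → Set
  TreeHeight h = (Σ (Fin n) λ v → HasHeight v h) × (∀ v k → HasHeight v k → k ≤ h)

  Balanced : Set
  Balanced = ∀ u v k → Adj u v → HasHeight u k → HasHeight v k → ⊥

  TotalDominating : Subset n → Set
  TotalDominating S = ∀ v → Σ (Fin n) λ u → u ∈ S × Adj u v

  MinimalTotalDominating : Subset n → Set
  MinimalTotalDominating S =
    TotalDominating S × (∀ S' → S' ⊂ S → ¬ TotalDominating S')

  WellTotallyDominated : Set
  WellTotallyDominated = ∀ S S' → MinimalTotalDominating S →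
    MinimalTotalDominating S' → ∣ S ∣ ≡ ∣ S' ∣

{-# OPTIONS --safe #-}
-- In a balanced tree the heights of adjacent vertices differ by exactly one, so a walk between
-- vertices of V₃ ∪ V₂ leaves this set only through V₁. Well-total domination forbids the two ways
-- such a detour could connect distinct vertices of height 2, each time by exhibiting minimal total
-- dominating sets of different sizes: a vertex of height 2 has a single neighbour in V₁ (otherwise
-- the two leaves dominating two such neighbours can be traded for the vertex itself), and a vertex
-- of height 1 has a single neighbour in V₂ (otherwise, with root at that vertex, dominating V₃
-- through the two neighbours yields a larger minimal set than dominating it through children).
-- Every detour through V₁ therefore returns to the vertex of height 2 where it started, and
-- acyclicity is inherited from T.
module Submission where

open import Defs
open import Data.Nat using (ℕ)
open import Data.Fin using (Fin)
open import Data.Sum using (_⊎_)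

open import Data.Bool using (Bool; true; false; if_then_else_)
open import Data.Bool.Properties using (¬-not) renaming (_≟_ to _≟ᵇ_)
open import Data.Empty using (⊥; ⊥-elim)
open import Data.Fin using (zero; suc)
open import Data.Fin.Properties using (any?; all?) renaming (_≟_ to _≟ᶠ_; suc-injective to suc-injectiveᶠ)
open import Data.Fin.Subset
  using (Subset; inside; outside; _∈_; _∉_; _⊆_; _⊂_; ∣_∣; _─_; _-_) renaming (⊥ to ∅)
open import Data.Fin.Subset.Properties
  using (_∈?_; _⊂?_; anySubset?; nonempty?; Empty-unique; ∣⊥∣≡0; p─⊥≡p; p─q⊆p; x∈⁅x⁆;
         x∈p∧x≢y⇒x∈p-y; x∈p⇒p-x⊂p; x∈p⇒∣p-x∣<∣p∣; p⊂q⇒p⊆q; p⊆q⇒∣p∣≤∣q∣)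
open import Data.Fin.Subset.Induction using (⊂-wellFounded)
open import Data.List using ([]; _∷_; tabulate)
open import Data.List.Properties using (map-tabulate)
open import Data.List.Membership.Propositional using () renaming (_∈_ to _∈ₗ_; _∉_ to _∉ₗ_)
open import Data.List.Relation.Binary.Subset.Propositional using () renaming (_⊆_ to _⊆ₗ_)
open import Data.List.Relation.Unary.All as All using (All; []; _∷_)
open import Data.List.Relation.Unary.All.Properties using (¬Any⇒All¬)
open import Data.List.Relation.Unary.Any using (here; there)
import Data.List.Relation.Unary.Any as Any using (any?)
open import Data.List.Relation.Unary.AllPairs using ([]; _∷_)
open import Data.List.Relation.Unary.Unique.Propositional using (Unique)
open import Data.Nat using (zero; suc; _+_; _≤_; _<_; z≤n; s≤s; _≟_)
open import Data.Nat.Induction using (<-wellFounded)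
open import Data.Nat.ListAction using (sum)
open import Data.Nat.Properties
  using (≤-trans; ≤-antisym; ≤-reflexive; ≤-pred; n≤0⇒n≡0; m≤n⇒m≤1+n; m≤m+n; m≤n+m;
         +-comm; +-identityʳ; +-monoʳ-≤; 1+n≰n; 1+n≢n; 0≢1+n; suc-injective; <-cmp; <-irrefl; ≮⇒≥;
         anyUpTo?; module ≤-Reasoning)
open import Data.Product using (Σ; ∃; _×_; _,_; proj₁; proj₂)
open import Data.Sum as Sum using (inj₁; inj₂)
open import Data.Unit using (tt)
open import Data.Vec.Properties using (lookup∘tabulate; lookup⇒[]=; []=⇒lookup)
import Data.Vec as Vec
open import Data.Vec using (_∷_; here; there)
open import Function using (_∘_; id)
open import Induction.WellFounded using (Acc; acc)
open import Relation.Binary using (tri<; tri≈; tri>)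
open import Relation.Binary.PropositionalEquality
  using (_≡_; _≢_; refl; sym; trans; cong; cong₂; subst; module ≡-Reasoning)
open import Relation.Nullary using (¬_; Dec; yes; no; does; contradiction)
open import Relation.Nullary.Decidable using (dec-true; map′; _×-dec_; _⊎-dec_; ¬?)
open import Relation.Unary using (Decidable)

private
  variable
    n : ℕ

consecutive : ∀ {i j} → i ≤ suc j → j ≤ suc i → i ≢ j → i ≡ suc j ⊎ j ≡ suc i
consecutive {i} {j} i≤1+j j≤1+i i≢j with <-cmp i j
... | tri< i<j _ _ = inj₂ (≤-antisym j≤1+i i<j)
... | tri≈ _ i≡j _ = contradiction i≡j i≢j
... | tri> _ _ j<i = inj₁ (≤-antisym i≤1+j j<i)

least-witness : {P : ℕ → Set} → Decidable P → ∀ {k} → P k →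
  ∃ λ m → P m × (∀ {i} → P i → m ≤ i)
least-witness {P} P? {k} = go k (<-wellFounded k)
  where
  go : ∀ k → Acc _<_ k → P k → ∃ λ m → P m × (∀ {i} → P i → m ≤ i)
  go k (acc smaller) pk with anyUpTo? P? k
  ... | yes (j , j<k , pj) = go j (smaller j<k) pj
  ... | no none = k , pk , λ pi → ≮⇒≥ λ i<k → none (_ , i<k , pi)

pick : {P : Fin n → Set} → Decidable P → Fin n → Fin n
pick P? default with any? P?
... | yes (i , _) = i
... | no _ = default

pick-satisfies : {P : Fin n → Set} (P? : Decidable P) (default : Fin n) → ∃ P → P (pick P? default)
pick-satisfies P? default ∃P with any? P?
... | yes (_ , Pi) = Pi
... | no ∄P = contradiction ∃P ∄P

subsetOf : {P : Fin n → Set} → Decidable P → Subset n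
subsetOf P? = Vec.tabulate (does ∘ P?)

module _ {P : Fin n → Set} (P? : Decidable P) where

  ∈-subsetOf⁺ : ∀ {x} → P x → x ∈ subsetOf P?
  ∈-subsetOf⁺ {x} Px = lookup⇒[]= x _ (trans (lookup∘tabulate (does ∘ P?) x) (dec-true (P? x) Px))

  ∈-subsetOf⁻ : ∀ {x} → x ∈ subsetOf P? → P x
  ∈-subsetOf⁻ {x} x∈ with P? x | trans (sym (lookup∘tabulate (does ∘ P?) x)) ([]=⇒lookup x∈)
  ... | yes Px | _ = Px
  ... | no _ | ()

x∈p─q⇒x∉q : ∀ {p q : Subset n} {x} → x ∈ p ─ q → x ∉ q
x∈p─q⇒x∉q {p = _ ∷ _} {q = inside ∷ _} () here
x∈p─q⇒x∉q {p = _ ∷ _} {q = _ ∷ _} (there x∈p─q) (there x∈q) = x∈p─q⇒x∉q x∈p─q x∈q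

x∈p-y⇒x≢y : ∀ {p : Subset n} {x y} → x ∈ p - y → x ≢ y
x∈p-y⇒x≢y x∈p-y refl = x∈p─q⇒x∉q x∈p-y (x∈⁅x⁆ _)

∣p∣≡1+∣p-x∣ : ∀ {p : Subset n} {x} → x ∈ p → ∣ p ∣ ≡ suc ∣ p - x ∣
∣p∣≡1+∣p-x∣ {p = inside ∷ p} here = cong (suc ∘ ∣_∣) (sym (p─⊥≡p p))
∣p∣≡1+∣p-x∣ {p = inside ∷ _} (there x∈p) = cong suc (∣p∣≡1+∣p-x∣ x∈p)
∣p∣≡1+∣p-x∣ {p = outside ∷ _} (there x∈p) = ∣p∣≡1+∣p-x∣ x∈p

module _ (f : Fin n → Fin n) where

  MapsInto : Subset n → Subset n → Set
  MapsInto p q = ∀ {i} → i ∈ p → f i ∈ q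

  InjectiveOn : Subset n → Set
  InjectiveOn p = ∀ {i j} → i ∈ p → j ∈ p → f i ≡ f j → i ≡ j

  injectiveOn⇒∣p∣≤∣q∣ : ∀ {p q} → MapsInto p q → InjectiveOn p → ∣ p ∣ ≤ ∣ q ∣
  injectiveOn⇒∣p∣≤∣q∣ {p} = go p (⊂-wellFounded p)
    where
    open ≤-Reasoning
    go : ∀ p {q} → Acc _⊂_ p → MapsInto p q → InjectiveOn p → ∣ p ∣ ≤ ∣ q ∣
    go p {q} (acc smaller) into injective with nonempty? p
    ... | no empty = begin
      ∣ p ∣            ≡⟨ cong ∣_∣ (Empty-unique empty) ⟩
      ∣ ∅ {n} ∣        ≡⟨ ∣⊥∣≡0 n ⟩
      0                ≤⟨ z≤n ⟩
      ∣ q ∣            ∎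
    ... | yes (i , i∈p) = begin
      ∣ p ∣            ≡⟨ ∣p∣≡1+∣p-x∣ i∈p ⟩
      suc ∣ p - i ∣    ≤⟨ s≤s (go (p - i) (smaller (x∈p⇒p-x⊂p i∈p)) into′ injective′) ⟩
      suc ∣ q - f i ∣  ≡⟨ sym (∣p∣≡1+∣p-x∣ (into i∈p)) ⟩
      ∣ q ∣            ∎
      where
      into′ : MapsInto (p - i) (q - f i)
      into′ j∈p-i = x∈p∧x≢y⇒x∈p-y (into (p─q⊆p p _ j∈p-i))
        (x∈p-y⇒x≢y j∈p-i ∘ injective (p─q⊆p p _ j∈p-i) i∈p)
      injective′ : InjectiveOn (p - i)
      injective′ j∈ k∈ = injective (p─q⊆p p _ j∈) (p─q⊆p p _ k∈)

  injectiveOn⇒∣p∣<∣q∣ : ∀ {p q j} → MapsInto p q → InjectiveOn p →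
    j ∈ q → (∀ {i} → i ∈ p → f i ≢ j) → ∣ p ∣ < ∣ q ∣
  injectiveOn⇒∣p∣<∣q∣ {p} {q} {j} into injective j∈q misses = begin-strict
    ∣ p ∣      ≤⟨ injectiveOn⇒∣p∣≤∣q∣ (λ i∈p → x∈p∧x≢y⇒x∈p-y (into i∈p) (misses i∈p)) injective ⟩
    ∣ q - j ∣  <⟨ x∈p⇒∣p-x∣<∣p∣ j∈q ⟩
    ∣ q ∣      ∎
    where open ≤-Reasoning

≤-sum-tabulate : ∀ {m} (f : Fin m → ℕ) i → f i ≤ sum (tabulate f)
≤-sum-tabulate f zero = m≤m+n (f zero) _
≤-sum-tabulate f (suc i) = ≤-trans (≤-sum-tabulate (f ∘ suc) i) (m≤n+m _ (f zero))

+-≤-sum-tabulate : ∀ {m} (f : Fin m → ℕ) {i j} → i ≢ j → f i + f j ≤ sum (tabulate f)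
+-≤-sum-tabulate f {zero} {zero} i≢j = contradiction refl i≢j
+-≤-sum-tabulate f {zero} {suc j} _ = +-monoʳ-≤ (f zero) (≤-sum-tabulate (f ∘ suc) j)
+-≤-sum-tabulate f {suc i} {zero} _ =
  ≤-trans (≤-reflexive (+-comm (f (suc i)) (f zero))) (+-monoʳ-≤ (f zero) (≤-sum-tabulate (f ∘ suc) i))
+-≤-sum-tabulate f {suc i} {suc j} i≢j =
  ≤-trans (+-≤-sum-tabulate (f ∘ suc) (i≢j ∘ cong suc)) (m≤n+m _ (f zero))

sum-tabulate-single : ∀ {m} (f : Fin m → ℕ) i → (∀ j → j ≢ i → f j ≡ 0) → sum (tabulate f) ≡ f i
sum-tabulate-single f zero others =
  trans (cong (f zero +_) (vanish (f ∘ suc) (λ j → others (suc j) λ ()))) (+-identityʳ (f zero))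
  where
  vanish : ∀ {m} (g : Fin m → ℕ) → (∀ j → g j ≡ 0) → sum (tabulate g) ≡ 0
  vanish {zero} g _ = refl
  vanish {suc m} g g≡0 =
    trans (cong (_+ sum (tabulate (g ∘ suc))) (g≡0 zero)) (vanish (g ∘ suc) (g≡0 ∘ suc))
sum-tabulate-single f (suc i) others =
  trans (cong (_+ sum (tabulate (f ∘ suc))) (others zero λ ()))
        (sum-tabulate-single (f ∘ suc) i λ j j≢i → others (suc j) (j≢i ∘ suc-injectiveᶠ))

module GraphProperties (G : Graph n) where
  open Graph G using (E)

  adj? : ∀ u v → Dec (Adj G u v)
  adj? u v = E u v ≟ᵇ true

  adj-sym : ∀ {u v} → Adj G u v → Adj G v u
  adj-sym {u} {v} e = trans (Graph.sym G v u) e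

  adj-irrefl : ∀ {v} → ¬ Adj G v v
  adj-irrefl {v} e = contradiction (trans (sym (Graph.irrefl G v)) e) λ ()

  adj⇒≢ : ∀ {u v} → Adj G u v → u ≢ v
  adj⇒≢ e refl = adj-irrefl e

  ¬adj⇒E≡false : ∀ {u v} → ¬ Adj G u v → E u v ≡ false
  ¬adj⇒E≡false = ¬-not

  walk-between : IsTree G → ∀ u v → ∃ (Walk G u v)
  walk-between (connected , _) u v with connected u v tt tt
  ... | k , W , _ = k , W

  indicator : Bool → ℕ
  indicator b = if b then 1 else 0

  degree≡sum : ∀ v → degree G v ≡ sum (tabulate (indicator ∘ E v))
  degree≡sum v = cong sum (map-tabulate id (indicator ∘ E v))

  leaf-adj-unique : ∀ {l u w} → IsLeaf G l → Adj G l u → Adj G l w → u ≡ w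
  leaf-adj-unique {l} {u} {w} leaf lu lw with u ≟ᶠ w
  ... | yes u≡w = u≡w
  ... | no u≢w = contradiction two≤one λ { (s≤s ()) }
    where
    open ≤-Reasoning
    two≤one : 2 ≤ 1
    two≤one = begin
      2                                      ≡⟨ sym (cong₂ _+_ (cong indicator lu) (cong indicator lw)) ⟩
      indicator (E l u) + indicator (E l w)  ≤⟨ +-≤-sum-tabulate (indicator ∘ E l) u≢w ⟩
      sum (tabulate (indicator ∘ E l))       ≡⟨ sym (degree≡sum l) ⟩
      degree G l                             ≡⟨ leaf ⟩
      1                                      ∎

  leaf-has-neighbour : ∀ {l} → IsLeaf G l → ∃ (Adj G l)
  leaf-has-neighbour {l} leaf with any? (adj? l)
  ... | yes neighbour = neighbour
  ... | no none = contradiction (trans (sym leaf) isolated) λ ()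
    where
    open ≡-Reasoning
    no-edge : ∀ w → indicator (E l w) ≡ 0
    no-edge w = cong indicator (¬adj⇒E≡false (none ∘ (w ,_)))
    isolated : degree G l ≡ 0
    isolated = begin
      degree G l                        ≡⟨ degree≡sum l ⟩
      sum (tabulate (indicator ∘ E l))  ≡⟨ sum-tabulate-single _ l (λ w _ → no-edge w) ⟩
      indicator (E l l)                 ≡⟨ cong indicator (Graph.irrefl G l) ⟩
      0                                 ∎

  second-neighbour : ∀ {v u} → ¬ IsLeaf G v → Adj G v u → ∃ λ w → Adj G v w × w ≢ u
  second-neighbour {v} {u} ¬leaf vu with any? (λ w → adj? v w ×-dec ¬? (w ≟ᶠ u))
  ... | yes other = other
  ... | no none = contradiction leaf ¬leaf
    where
    open ≡-Reasoning
    no-other-edge : ∀ w → w ≢ u → indicator (E v w) ≡ 0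
    no-other-edge w w≢u = cong indicator (¬adj⇒E≡false λ vw → none (w , vw , w≢u))
    leaf : IsLeaf G v
    leaf = begin
      degree G v                        ≡⟨ degree≡sum v ⟩
      sum (tabulate (indicator ∘ E v))  ≡⟨ sum-tabulate-single _ u no-other-edge ⟩
      indicator (E v u)                 ≡⟨ cong indicator vu ⟩
      1                                 ∎

  infixr 5 _++ʷ_
  infixl 5 _∷ʳ_

  _++ʷ_ : ∀ {u v w j k} → Walk G u v j → Walk G v w k → Walk G u w (j + k)
  [] ++ʷ W = W
  (e ∷ V) ++ʷ W = e ∷ (V ++ʷ W)

  _∷ʳ_ : ∀ {u v w k} → Walk G u v k → Adj G v w → Walk G u w (suc k)
  [] ∷ʳ e = e ∷ []
  (e′ ∷ W) ∷ʳ e = e′ ∷ (W ∷ʳ e)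

  reverse : ∀ {u v k} → Walk G u v k → Walk G v u k
  reverse [] = []
  reverse (e ∷ W) = reverse W ∷ʳ adj-sym e

  ∈-++ʷ⁻ : ∀ {u v w j k x} (V : Walk G u v j) {W : Walk G v w k} →
    x ∈ₗ verts G (V ++ʷ W) → x ∈ₗ verts G V ⊎ x ∈ₗ verts G W
  ∈-++ʷ⁻ [] x∈W = inj₂ x∈W
  ∈-++ʷ⁻ (e ∷ V) (here x≡u) = inj₁ (here x≡u)
  ∈-++ʷ⁻ (e ∷ V) (there x∈) = Sum.map₁ there (∈-++ʷ⁻ V x∈)

  ∈-∷ʳ⁻ : ∀ {u v w k x} (W : Walk G u v k) {e : Adj G v w} →
    x ∈ₗ verts G (W ∷ʳ e) → x ∈ₗ verts G W ⊎ x ≡ w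
  ∈-∷ʳ⁻ [] (here x≡u) = inj₁ (here x≡u)
  ∈-∷ʳ⁻ [] (there (here x≡w)) = inj₂ x≡w
  ∈-∷ʳ⁻ (e′ ∷ W) (here x≡u) = inj₁ (here x≡u)
  ∈-∷ʳ⁻ (e′ ∷ W) (there x∈) = Sum.map₁ there (∈-∷ʳ⁻ W x∈)

  ∈-reverse⁻ : ∀ {u v k x} (W : Walk G u v k) → x ∈ₗ verts G (reverse W) → x ∈ₗ verts G W
  ∈-reverse⁻ [] x∈ = x∈
  ∈-reverse⁻ (e ∷ W) x∈ with ∈-∷ʳ⁻ (reverse W) x∈
  ... | inj₁ x∈W = there (∈-reverse⁻ W x∈W)
  ... | inj₂ refl = here refl

  suffix-from : ∀ {u v k x} (W : Walk G u v k) → x ∈ₗ verts G W →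
    ∃ λ j → Σ (Walk G x v j) λ W′ →
      verts G W′ ⊆ₗ verts G W × (Unique (verts G W) → Unique (verts G W′))
  suffix-from [] (here refl) = _ , [] , id , id
  suffix-from (e ∷ W) (here refl) = _ , e ∷ W , id , id
  suffix-from (e ∷ W) (there x∈W) with suffix-from W x∈W
  ... | j , W′ , W′⊆W , unique = j , W′ , there ∘ W′⊆W , λ { (_ ∷ u) → unique u }

  loop-erase : ∀ {u v k} (W : Walk G u v k) →
    ∃ λ j → Σ (Walk G u v j) λ P → Unique (verts G P) × verts G P ⊆ₗ verts G W
  loop-erase [] = 0 , [] , [] ∷ [] , id
  loop-erase {u} (e ∷ W) with loop-erase W
  ... | j , P , unique , P⊆W with Any.any? (u ≟ᶠ_) (verts G P)
  ...   | yes u∈P = let (i , P′ , P′⊆P , unique′) = suffix-from P u∈P in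
                    i , P′ , unique′ unique , there ∘ P⊆W ∘ P′⊆P
  ...   | no u∉P = suc j , e ∷ P , ¬Any⇒All¬ _ u∉P ∷ unique ,
                   λ { (here refl) → here refl ; (there x∈) → there (P⊆W x∈) }

  tree-detour-free : IsTree G → ∀ {v u w k} → Adj G v u → Adj G v w → u ≢ w →
    (W : Walk G u w k) → v ∉ₗ verts G W → ⊥
  tree-detour-free (_ , acyclic) {v} vu vw u≢w W v∉W with loop-erase W
  ... | zero , [] , _ , _ = u≢w refl
  ... | suc j , P , unique , P⊆W =
    acyclic (v , _ , j , vu ∷ P , ¬Any⇒All¬ _ (v∉W ∘ P⊆W) ∷ unique , All.universal _ _ , adj-sym vw)

  tree-cycle-free : IsTree G → ∀ P → ¬ CycleOn G P
  tree-cycle-free (_ , acyclic) P (u , v , k , W , unique , _ , vu) =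
    acyclic (u , v , k , W , unique , All.universal _ _ , vu)

  totalDominating? : Decidable (TotalDominating G)
  totalDominating? S = all? λ v → any? λ u → (u ∈? S) ×-dec adj? u v

  opaque
    minimal-total-dominating-⊆ : ∀ {S} → TotalDominating G S →
      ∃ λ M → M ⊆ S × MinimalTotalDominating G M
    minimal-total-dominating-⊆ {S} = go S (⊂-wellFounded S)
      where
      go : ∀ S → Acc _⊂_ S → TotalDominating G S → ∃ λ M → M ⊆ S × MinimalTotalDominating G M
      go S (acc smaller) dominating with anySubset? (λ S′ → (S′ ⊂? S) ×-dec totalDominating? S′)
      ... | yes (S′ , S′⊂S , dominating′) =
        let (M , M⊆S′ , minimal) = go S′ (smaller S′⊂S) dominating′ in
        M , p⊂q⇒p⊆q S′⊂S ∘ M⊆S′ , minimal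
      ... | no none = S , id , dominating , λ S′ S′⊂S dominating′ → none (S′ , S′⊂S , dominating′)

  leaf-neighbour-∈ : ∀ {S l s} → TotalDominating G S → IsLeaf G l → Adj G l s → s ∈ S
  leaf-neighbour-∈ {S} dominating leaf ls with dominating _
  ... | u , u∈S , ul = subst (_∈ S) (leaf-adj-unique leaf (adj-sym ul) ls) u∈S

  leaf-private : ∀ {M l y u} → MinimalTotalDominating G M → l ∈ M → IsLeaf G l → Adj G l y →
    u ∈ M → Adj G u y → u ≡ l
  leaf-private {M} {l} {y} {u} (dominating , minimal) l∈M leaf ly u∈M uy with u ≟ᶠ l
  ... | yes u≡l = u≡l
  ... | no u≢l = contradiction dominating′ (minimal (M - l) (x∈p⇒p-x⊂p l∈M))
    where
    dominating′ : TotalDominating G (M - l)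
    dominating′ w with dominating w
    ... | v , v∈M , vw with v ≟ᶠ l
    ...   | yes refl = u , x∈p∧x≢y⇒x∈p-y u∈M u≢l , subst (Adj G u) (leaf-adj-unique leaf ly vw) uy
    ...   | no v≢l = v , x∈p∧x≢y⇒x∈p-y v∈M v≢l , vw

  -- Replacing lx and ly by p keeps M total dominating, as x and y are their only neighbours.
  leaf-swap : ∀ {M lx ly x y p} → TotalDominating G M → lx ∈ M → ly ∈ M → lx ≢ ly →
    IsLeaf G lx → IsLeaf G ly → Adj G lx x → Adj G ly y → Adj G p x → Adj G p y →
    ∃ λ M′ → MinimalTotalDominating G M′ × ∣ M′ ∣ < ∣ M ∣
  leaf-swap {M} {lx} {ly} {x} {y} {p} M-dominating lx∈M ly∈M lx≢ly lx-leaf ly-leaf lx-x ly-y px py =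
    let (M′ , M′⊆N , M′-minimal) = minimal-total-dominating-⊆ N-dominating in
    M′ , M′-minimal , (begin-strict
      ∣ M′ ∣  ≤⟨ p⊆q⇒∣p∣≤∣q∣ M′⊆N ⟩
      ∣ N ∣   <⟨ injectiveOn⇒∣p∣<∣q∣ replace replace-∈ replace-injective ly∈M replace-≢ly ⟩
      ∣ M ∣   ∎)
    where
    open ≤-Reasoning
    Kept : Fin n → Set
    Kept q = q ∈ M × q ≢ lx × q ≢ ly

    N? : Decidable λ q → Kept q ⊎ q ≡ p
    N? q = ((q ∈? M) ×-dec ¬? (q ≟ᶠ lx) ×-dec ¬? (q ≟ᶠ ly)) ⊎-dec (q ≟ᶠ p)

    N : Subset n
    N = subsetOf N?

    N-dominating : TotalDominating G N
    N-dominating w with M-dominating w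
    ... | u , u∈M , uw with u ≟ᶠ lx | u ≟ᶠ ly
    ... | yes refl | _ = p , ∈-subsetOf⁺ N? (inj₂ refl) , subst (Adj G p) (leaf-adj-unique lx-leaf lx-x uw) px
    ... | no _ | yes refl = p , ∈-subsetOf⁺ N? (inj₂ refl) , subst (Adj G p) (leaf-adj-unique ly-leaf ly-y uw) py
    ... | no u≢lx | no u≢ly = u , ∈-subsetOf⁺ N? (inj₁ (u∈M , u≢lx , u≢ly)) , uw

    kept : ∀ {q} → q ∈ N → q ≢ p → Kept q
    kept q∈N q≢p = Sum.[ id , (λ q≡p → contradiction q≡p q≢p) ] (∈-subsetOf⁻ N? q∈N)

    replace : Fin n → Fin n
    replace q with q ≟ᶠ p
    ... | yes _ = lx
    ... | no _ = q

    replace-∈ : MapsInto replace N M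
    replace-∈ {q} q∈N with q ≟ᶠ p
    ... | yes _ = lx∈M
    ... | no q≢p = proj₁ (kept q∈N q≢p)

    replace-injective : InjectiveOn replace N
    replace-injective {i} {j} i∈N j∈N with i ≟ᶠ p | j ≟ᶠ p
    ... | yes i≡p | yes j≡p = λ _ → trans i≡p (sym j≡p)
    ... | yes _ | no j≢p = λ lx≡j → contradiction (sym lx≡j) (proj₁ (proj₂ (kept j∈N j≢p)))
    ... | no i≢p | yes _ = λ i≡lx → contradiction i≡lx (proj₁ (proj₂ (kept i∈N i≢p)))
    ... | no _ | no _ = id

    replace-≢ly : ∀ {i} → i ∈ N → replace i ≢ ly
    replace-≢ly {i} i∈N with i ≟ᶠ p
    ... | yes _ = lx≢ly
    ... | no i≢p = proj₂ (proj₂ (kept i∈N i≢p))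

module DistanceTo (G : Graph n) (Z : Fin n → Set) (Z? : Decidable Z)
                  (reach : ∀ v → Σ (Fin n) λ t → Z t × ∃ (Walk G v t)) where
  open GraphProperties G

  DistanceIs : Fin n → ℕ → Set
  DistanceIs v k = (Σ (Fin n) λ t → Z t × Walk G v t k) × (∀ t j → Z t → Walk G v t j → k ≤ j)

  reaches? : ∀ k v → Dec (Σ (Fin n) λ t → Z t × Walk G v t k)
  reaches? zero v = map′ (λ z → v , z , []) (λ { (_ , z , []) → z }) (Z? v)
  reaches? (suc k) v = map′ (λ (w , e , t , z , W) → t , z , e ∷ W)
                             (λ { (t , z , e ∷ W) → _ , e , t , z , W })
                             (any? λ w → adj? v w ×-dec reaches? k w)

  opaque
    distance : ∀ v → ∃ (DistanceIs v)
    distance v with reach v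
    ... | t , z , k , W with least-witness (λ j → reaches? j v) (t , z , W)
    ... | m , walk , shortest = m , walk , λ t j z W → shortest (t , z , W)

  dist : Fin n → ℕ
  dist v = proj₁ (distance v)

  dist-is : ∀ v → DistanceIs v (dist v)
  dist-is v = proj₂ (distance v)

  DistanceIs-unique : ∀ {v j k} → DistanceIs v j → DistanceIs v k → j ≡ k
  DistanceIs-unique ((t , z , W) , shortest) ((t′ , z′ , W′) , shortest′) =
    ≤-antisym (shortest t′ _ z′ W′) (shortest′ t _ z W)

  dist-minimal : ∀ {v t k} → Z t → Walk G v t k → dist v ≤ k
  dist-minimal z W = proj₂ (dist-is _) _ _ z W

  dist-adj : ∀ {u v} → Adj G u v → dist u ≤ suc (dist v)
  dist-adj e with proj₁ (dist-is _)
  ... | t , z , W = dist-minimal z (e ∷ W)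

  dist-along : ∀ {v t k x} → Z t → (W : Walk G v t k) → x ∈ₗ verts G W → dist x ≤ k
  dist-along z [] (here refl) = dist-minimal z []
  dist-along z (e ∷ W) (here refl) = dist-minimal z (e ∷ W)
  dist-along z (e ∷ W) (there x∈W) = m≤n⇒m≤1+n (dist-along z W x∈W)

  Z⇒dist≡0 : ∀ {v} → Z v → dist v ≡ 0
  Z⇒dist≡0 z = n≤0⇒n≡0 (dist-minimal z [])

  dist≡0⇒Z : ∀ {v} → dist v ≡ 0 → Z v
  dist≡0⇒Z {v} eq = at-zero (subst (DistanceIs v) eq (dist-is v))
    where
    at-zero : DistanceIs v 0 → Z v
    at-zero ((_ , z , []) , _) = z

  dist-parent : ∀ {v} → ¬ Z v → ∃ λ w → Adj G v w × dist v ≡ suc (dist w)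
  dist-parent {v} ¬z = first-step (dist-is v)
    where
    first-step : ∀ {k} → DistanceIs v k → ∃ λ w → Adj G v w × k ≡ suc (dist w)
    first-step ((_ , z , []) , _) = contradiction z ¬z
    first-step ((_ , z , e ∷ W) , shortest) with proj₁ (dist-is _)
    ... | _ , z′ , W′ = _ , e , cong suc (≤-antisym (≤-pred (shortest _ _ z′ (e ∷ W′))) (dist-minimal z W))

module RootedTree (T : Graph n) (tree : IsTree T) (root : Fin n) where
  open GraphProperties T
  open DistanceTo T (_≡ root) (_≟ᶠ root) (λ v → root , refl , walk-between tree v root)
    renaming (dist to depth; dist-adj to depth-adj; dist-parent to parent)

  Child : Fin n → Fin n → Set
  Child v r = Adj T v r × depth r ≡ suc (depth v)

  child? : ∀ v r → Dec (Child v r)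
  child? v r = adj? v r ×-dec (depth r ≟ suc (depth v))

  depth-root : depth root ≡ 0
  depth-root = Z⇒dist≡0 refl

  walk-through-root : ∀ u w → ∃ λ k → Σ (Walk T u w k) λ W →
    ∀ {x} → x ∈ₗ verts T W → depth x ≤ depth u ⊎ depth x ≤ depth w
  walk-through-root u w with proj₁ (dist-is u) | proj₁ (dist-is w)
  ... | _ , refl , U | _ , refl , W =
    _ , U ++ʷ reverse W , Sum.map (dist-along refl U) (dist-along refl W ∘ ∈-reverse⁻ W) ∘ ∈-++ʷ⁻ U

  parent-unique : ∀ {u w v} → Child u v → Child w v → u ≡ w
  parent-unique {u} {w} {v} (uv , v-below-u) (wv , v-below-w) with u ≟ᶠ w
  ... | yes u≡w = u≡w
  ... | no u≢w with walk-through-root u w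
  ... | _ , W , shallow = ⊥-elim (tree-detour-free tree (adj-sym uv) (adj-sym wv) u≢w W
          (Sum.[ 1+n≰n ∘ subst (_≤ _) v-below-u , 1+n≰n ∘ subst (_≤ _) v-below-w ] ∘ shallow))

  adjacent-depths-differ : ∀ {u v} → Adj T u v → depth u ≢ depth v
  adjacent-depths-differ {u} {v} uv same with u ≟ᶠ root
  ... | yes refl = adj⇒≢ uv (sym (dist≡0⇒Z (trans (sym same) depth-root)))
  ... | no u≢root with parent u≢root | parent v≢root
    where
    v≢root : v ≢ root
    v≢root v≡root = u≢root (dist≡0⇒Z (trans same (Z⇒dist≡0 v≡root)))
  ... | pu , u-pu , u-below-pu | pv , v-pv , v-below-pv with walk-through-root pv pu
  ... | _ , W , shallow = tree-detour-free tree uv u-pu v≢pu (v-pv ∷ W) u∉W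
    where
    v≢pu : v ≢ pu
    v≢pu refl = 1+n≢n (trans (sym u-below-pu) same)
    u∉W : u ∉ₗ verts T (v-pv ∷ W)
    u∉W (here u≡v) = adj⇒≢ uv u≡v
    u∉W (there u∈W) =
      Sum.[ 1+n≰n ∘ subst (_≤ _) (trans same v-below-pv) , 1+n≰n ∘ subst (_≤ _) u-below-pu ] (shallow u∈W)

  adjacent⇒child : ∀ {u v} → Adj T u v → Child u v ⊎ Child v u
  adjacent⇒child {u} {v} uv =
    Sum.[ (λ u-below → inj₂ (adj-sym uv , u-below)) , (λ v-below → inj₁ (uv , v-below)) ]
      (consecutive (depth-adj uv) (depth-adj (adj-sym uv)) (adjacent-depths-differ uv))

  root-child : ∀ {v} → Adj T root v → Child root v
  root-child rv with adjacent⇒child rv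
  ... | inj₁ root→v = root→v
  ... | inj₂ (_ , root-below) = ⊥-elim (0≢1+n (trans (sym depth-root) root-below))

  child≢root : ∀ {v r} → Child v r → r ≢ root
  child≢root (_ , r-below) refl = 0≢1+n (trans (sym depth-root) r-below)

  child-exists : ∀ {c} → c ≢ root → ¬ IsLeaf T c → ∃ (Child c)
  child-exists c≢root ¬leaf with parent c≢root
  ... | p , cp , c-below-p with second-neighbour ¬leaf cp
  ... | r , cr , r≢p with adjacent⇒child cr
  ... | inj₁ c→r = r , c→r
  ... | inj₂ r→c = contradiction (parent-unique r→c (adj-sym cp , c-below-p)) r≢p

  neighbour-of-child : ∀ {v r z} → Child v r → Adj T r z → z ≡ v ⊎ Child r z
  neighbour-of-child v→r rz with adjacent⇒child rz
  ... | inj₁ r→z = inj₂ r→z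
  ... | inj₂ z→r = inj₁ (parent-unique z→r v→r)


module BalancedHeight3Tree (T : Graph n) (tree : IsTree T) (balanced : Balanced T) (height-3 : TreeHeight T 3) where
  open GraphProperties T

  private
    leaf₀ : Σ (Fin n) (IsLeaf T)
    leaf₀ = let ((_ , (l , leaf , _) , _) , _) = height-3 in l , leaf

  -- With Z = IsLeaf T, DistanceIs is definitionally HasHeight T.
  open DistanceTo T (IsLeaf T) (λ v → degree T v ≟ 1)
         (λ v → proj₁ leaf₀ , proj₂ leaf₀ , walk-between tree v (proj₁ leaf₀))
    renaming (dist to height; dist-is to has-height)

  HasHeight⇒height≡ : ∀ {v k} → HasHeight T v k → height v ≡ k
  HasHeight⇒height≡ = DistanceIs-unique (has-height _)

  height≡⇒HasHeight : ∀ {v k} → height v ≡ k → HasHeight T v k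
  height≡⇒HasHeight {v} v-k = subst (HasHeight T v) v-k (has-height v)

  height≤3 : ∀ v → height v ≤ 3
  height≤3 v = proj₂ height-3 v _ (has-height v)

  heights-differ : ∀ {u v j k} → height u ≡ j → height v ≡ k → j ≢ k → u ≢ v
  heights-differ u-j v-k j≢k refl = j≢k (trans (sym u-j) v-k)

  height-cases : ∀ v → height v ≡ 0 ⊎ height v ≡ 1 ⊎ height v ≡ 2 ⊎ height v ≡ 3
  height-cases v with height v | height≤3 v
  ... | 0 | _ = inj₁ refl
  ... | 1 | _ = inj₂ (inj₁ refl)
  ... | 2 | _ = inj₂ (inj₂ (inj₁ refl))
  ... | 3 | _ = inj₂ (inj₂ (inj₂ refl))
  ... | suc (suc (suc (suc _))) | s≤s (s≤s (s≤s ()))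

  adjacent-heights : ∀ {u v} → Adj T u v → height u ≡ suc (height v) ⊎ height v ≡ suc (height u)
  adjacent-heights uv = consecutive (dist-adj uv) (dist-adj (adj-sym uv))
    λ same → balanced _ _ _ uv (has-height _) (height≡⇒HasHeight (sym same))

  positive-height⇒¬leaf : ∀ {v k} → height v ≡ suc k → ¬ IsLeaf T v
  positive-height⇒¬leaf v-sk leaf = 0≢1+n (trans (sym (Z⇒dist≡0 leaf)) v-sk)

  height≡0⇒leaf : ∀ {v} → height v ≡ 0 → IsLeaf T v
  height≡0⇒leaf = dist≡0⇒Z

  lower-neighbour : ∀ {v k} → height v ≡ suc k → ∃ λ w → Adj T v w × height w ≡ k
  lower-neighbour v-sk with dist-parent (positive-height⇒¬leaf v-sk)
  ... | w , vw , v-above-w = w , vw , suc-injective (trans (sym v-above-w) v-sk)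

  neighbour-of-height-0 : ∀ {u w} → height u ≡ 0 → Adj T u w → height w ≡ 1
  neighbour-of-height-0 u-0 uw with adjacent-heights uw
  ... | inj₁ u-above = ⊥-elim (0≢1+n (trans (sym u-0) u-above))
  ... | inj₂ w-above = trans w-above (cong suc u-0)

  neighbour-of-height-suc : ∀ {u w k} → height u ≡ suc k → Adj T u w → height w ≡ k ⊎ height w ≡ suc (suc k)
  neighbour-of-height-suc u-sk uw with adjacent-heights uw
  ... | inj₁ u-above = inj₁ (suc-injective (trans (sym u-above) u-sk))
  ... | inj₂ w-above = inj₂ (trans w-above (cong suc u-sk))

  neighbour-of-height-3 : ∀ {u w} → height u ≡ 3 → Adj T u w → height w ≡ 2
  neighbour-of-height-3 {w = w} u-3 uw with neighbour-of-height-suc u-3 uw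
  ... | inj₁ w-2 = w-2
  ... | inj₂ w-4 = contradiction (subst (_≤ 3) w-4 (height≤3 w)) λ { (s≤s (s≤s (s≤s ()))) }

  Low : Fin n → Set
  Low v = height v ≡ 0 ⊎ height v ≡ 1

  low? : Decidable Low
  low? v = (height v ≟ 0) ⊎-dec (height v ≟ 1)

  low⇒height≢2 : ∀ {v} → Low v → height v ≢ 2
  low⇒height≢2 (inj₁ v-0) v-2 = contradiction (trans (sym v-0) v-2) λ ()
  low⇒height≢2 (inj₂ v-1) v-2 = contradiction (trans (sym v-1) v-2) λ ()

  height-3-or-low-dominated : ∀ v → height v ≡ 3 ⊎ ∃ λ u → Low u × Adj T u v
  height-3-or-low-dominated v with height-cases v
  ... | inj₁ v-0 = let (u , vu) = leaf-has-neighbour (height≡0⇒leaf v-0) in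
                   inj₂ (u , inj₂ (neighbour-of-height-0 v-0 vu) , adj-sym vu)
  ... | inj₂ (inj₁ v-1) = let (u , vu , u-0) = lower-neighbour v-1 in inj₂ (u , inj₁ u-0 , adj-sym vu)
  ... | inj₂ (inj₂ (inj₁ v-2)) = let (u , vu , u-1) = lower-neighbour v-2 in inj₂ (u , inj₂ u-1 , adj-sym vu)
  ... | inj₂ (inj₂ (inj₂ v-3)) = inj₁ v-3

  module _ (wtd : WellTotallyDominated T) where

    module TwoLowerNeighbours {p x y} (p-2 : height p ≡ 2) (x-1 : height x ≡ 1) (y-1 : height y ≡ 1)
                              (px : Adj T p x) (py : Adj T p y) (x≢y : x ≢ y) where
      open RootedTree T tree p

      -- In a minimal M ⊆ S the vertices x and y can only be dominated by leaves,
      -- and leaf-swap then yields a smaller minimal total dominating set.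
      Excluded : Fin n → Set
      Excluded q = height q ≡ 2 × (Adj T q x ⊎ Adj T q y)

      S? : Decidable (¬_ ∘ Excluded)
      S? q = ¬? ((height q ≟ 2) ×-dec (adj? q x ⊎-dec adj? q y))

      S : Subset n
      S = subsetOf S?

      child-far-from-root : ∀ {v r z} → Child v r → height v ≡ 3 → Adj T p z → height z ≡ 1 → ¬ Adj T r z
      child-far-from-root v→r v-3 pz z-1 rz with neighbour-of-child v→r rz
      ... | inj₁ z≡v = heights-differ z-1 v-3 (λ ()) z≡v
      ... | inj₂ r→z = child≢root v→r (sym (parent-unique (root-child pz) r→z))

      S-dominating : TotalDominating T S
      S-dominating v with height-3-or-low-dominated v
      ... | inj₂ (u , u-low , uv) = u , ∈-subsetOf⁺ S? (low⇒height≢2 u-low ∘ proj₁) , uv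
      ... | inj₁ v-3 =
        let (r , v→r) = child-exists (heights-differ v-3 p-2 λ ()) (positive-height⇒¬leaf v-3) in
        r , ∈-subsetOf⁺ S? (Sum.[ child-far-from-root v→r v-3 px x-1 , child-far-from-root v→r v-3 py y-1 ] ∘ proj₂) ,
        adj-sym (proj₁ v→r)

      M-spec : ∃ λ M → M ⊆ S × MinimalTotalDominating T M
      M-spec = minimal-total-dominating-⊆ S-dominating

      M : Subset n
      M = proj₁ M-spec

      M⊆S : M ⊆ S
      M⊆S = proj₁ (proj₂ M-spec)

      M-minimal : MinimalTotalDominating T M
      M-minimal = proj₂ (proj₂ M-spec)

      leaf-dominator : ∀ {z} → height z ≡ 1 → (∀ {u} → Adj T u z → Adj T u x ⊎ Adj T u y) →
        ∃ λ l → l ∈ M × IsLeaf T l × Adj T l z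
      leaf-dominator {z} z-1 next-to-xy with proj₁ M-minimal z
      ... | u , u∈M , uz with neighbour-of-height-suc z-1 (adj-sym uz)
      ... | inj₁ u-0 = u , u∈M , height≡0⇒leaf u-0 , uz
      ... | inj₂ u-2 = contradiction (u-2 , next-to-xy uz) (∈-subsetOf⁻ S? (M⊆S u∈M))

      absurd : ⊥
      absurd with leaf-dominator x-1 inj₁ | leaf-dominator y-1 inj₂
      ... | lx , lx∈M , lx-leaf , lx-x | ly , ly∈M , ly-leaf , ly-y =
        let (M′ , M′-minimal , M′<M) = leaf-swap (proj₁ M-minimal) lx∈M ly∈M lx≢ly lx-leaf ly-leaf lx-x ly-y px py
        in <-irrefl (wtd M′ M M′-minimal M-minimal) M′<M
        where
        lx≢ly : lx ≢ ly
        lx≢ly refl = x≢y (leaf-adj-unique lx-leaf lx-x ly-y)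

    V₁-neighbour-unique : ∀ {u y y′} → Adj T u y → Adj T u y′ → height y ≡ 1 → height y′ ≡ 1 → y ≡ y′
    V₁-neighbour-unique {u} {y} {y′} uy uy′ y-1 y′-1 with y ≟ᶠ y′
    ... | yes y≡y′ = y≡y′
    ... | no y≢y′ with neighbour-of-height-suc y-1 (adj-sym uy)
    ... | inj₁ u-0 = leaf-adj-unique (height≡0⇒leaf u-0) uy uy′
    ... | inj₂ u-2 = ⊥-elim (TwoLowerNeighbours.absurd u-2 y-1 y′-1 uy uy′ y≢y′)

    module TwoUpperNeighbours {x a b} (x-1 : height x ≡ 1) (a-2 : height a ≡ 2) (b-2 : height b ≡ 2)
                              (xa : Adj T x a) (xb : Adj T x b) (a≢b : a ≢ b) where
      open RootedTree T tree x

      -- S₁ dominates the height-3 neighbours of a and b by a and b, S₂ dominates every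
      -- height-3 vertex by a child; a minimal M₁ ⊆ S₁ is then larger than a minimal M₂ ⊆ S₂.
      NextToAB : Fin n → Set
      NextToAB c = Adj T c a ⊎ Adj T c b

      ChildOfV₃ : Fin n → Fin n → Set
      ChildOfV₃ c q = Child c q × height c ≡ 3

      S₁? : Decidable λ q → Low q ⊎ (q ≡ a ⊎ q ≡ b) ⊎ ∃ λ c → ChildOfV₃ c q × ¬ NextToAB c
      S₁? q = low? q ⊎-dec ((q ≟ᶠ a) ⊎-dec (q ≟ᶠ b)) ⊎-dec
              any? (λ c → (child? c q ×-dec (height c ≟ 3)) ×-dec ¬? (adj? c a ⊎-dec adj? c b))

      S₂? : Decidable λ q → Low q ⊎ ∃ λ c → ChildOfV₃ c q
      S₂? q = low? q ⊎-dec any? (λ c → child? c q ×-dec (height c ≟ 3))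

      S₁ S₂ : Subset n
      S₁ = subsetOf S₁?
      S₂ = subsetOf S₂?

      V₃-child : ∀ {v} → height v ≡ 3 → ∃ (Child v)
      V₃-child v-3 = child-exists (heights-differ v-3 x-1 λ ()) (positive-height⇒¬leaf v-3)

      S₁-dominating : TotalDominating T S₁
      S₁-dominating v with height-3-or-low-dominated v
      ... | inj₂ (u , u-low , uv) = u , ∈-subsetOf⁺ S₁? (inj₁ u-low) , uv
      ... | inj₁ v-3 with adj? v a | adj? v b
      ... | yes va | _ = a , ∈-subsetOf⁺ S₁? (inj₂ (inj₁ (inj₁ refl))) , adj-sym va
      ... | no _ | yes vb = b , ∈-subsetOf⁺ S₁? (inj₂ (inj₁ (inj₂ refl))) , adj-sym vb
      ... | no ¬va | no ¬vb = let (r , v→r) = V₃-child v-3 in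
        r , ∈-subsetOf⁺ S₁? (inj₂ (inj₂ (v , (v→r , v-3) , Sum.[ ¬va , ¬vb ]))) , adj-sym (proj₁ v→r)

      S₂-dominating : TotalDominating T S₂
      S₂-dominating v with height-3-or-low-dominated v
      ... | inj₂ (u , u-low , uv) = u , ∈-subsetOf⁺ S₂? (inj₁ u-low) , uv
      ... | inj₁ v-3 = let (r , v→r) = V₃-child v-3 in
        r , ∈-subsetOf⁺ S₂? (inj₂ (v , v→r , v-3)) , adj-sym (proj₁ v→r)

      M₁-spec : ∃ λ M → M ⊆ S₁ × MinimalTotalDominating T M
      M₁-spec = minimal-total-dominating-⊆ S₁-dominating

      M₂-spec : ∃ λ M → M ⊆ S₂ × MinimalTotalDominating T M
      M₂-spec = minimal-total-dominating-⊆ S₂-dominating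

      M₁ M₂ : Subset n
      M₁ = proj₁ M₁-spec
      M₂ = proj₁ M₂-spec

      M₁⊆S₁ : M₁ ⊆ S₁
      M₁⊆S₁ = proj₁ (proj₂ M₁-spec)

      M₂⊆S₂ : M₂ ⊆ S₂
      M₂⊆S₂ = proj₁ (proj₂ M₂-spec)

      M₁-minimal : MinimalTotalDominating T M₁
      M₁-minimal = proj₂ (proj₂ M₁-spec)

      M₂-minimal : MinimalTotalDominating T M₂
      M₂-minimal = proj₂ (proj₂ M₂-spec)

      parent-of-NextToAB-∈M₁ : ∀ {q c} → Child q c → height c ≡ 3 → NextToAB c → q ∈ M₁
      parent-of-NextToAB-∈M₁ {q} {c} q→c c-3 c-near with proj₁ M₁-minimal c
      ... | u , u∈M₁ , uc with neighbour-of-child q→c (adj-sym uc)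
      ... | inj₁ u≡q = subst (_∈ M₁) u≡q u∈M₁
      ... | inj₂ c→u with ∈-subsetOf⁻ S₁? (M₁⊆S₁ u∈M₁)
      ... | inj₁ u-low = ⊥-elim (low⇒height≢2 u-low (neighbour-of-height-3 c-3 (proj₁ c→u)))
      ... | inj₂ (inj₁ u∈ab) = ⊥-elim (heights-differ x-1 c-3 (λ ()) (parent-unique (root-child x-u) c→u))
        where
        x-u : Adj T x _
        x-u = Sum.[ (λ { refl → xa }) , (λ { refl → xb }) ] u∈ab
      ... | inj₂ (inj₂ (c′ , (c′→u , _) , c′-far)) = ⊥-elim (c′-far (subst NextToAB (parent-unique c→u c′→u) c-near))

      V₃-child-of-V₂-neighbour : ∀ {q} → height q ≡ 2 → Adj T x q → ∃ λ c → Child q c × height c ≡ 3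
      V₃-child-of-V₂-neighbour q-2 xq with child-exists (heights-differ q-2 x-1 λ ()) (positive-height⇒¬leaf q-2)
      ... | c , q→c with neighbour-of-height-suc q-2 (proj₁ q→c)
      ... | inj₁ c-1 = ⊥-elim (child≢root q→c (V₁-neighbour-unique (proj₁ q→c) (adj-sym xq) c-1 x-1))
      ... | inj₂ c-3 = c , q→c , c-3

      a∈M₁ : a ∈ M₁
      a∈M₁ = let (c , a→c , c-3) = V₃-child-of-V₂-neighbour a-2 xa in
             parent-of-NextToAB-∈M₁ a→c c-3 (inj₁ (adj-sym (proj₁ a→c)))

      b∈M₁ : b ∈ M₁
      b∈M₁ = let (c , b→c , c-3) = V₃-child-of-V₂-neighbour b-2 xb in
             parent-of-NextToAB-∈M₁ b→c c-3 (inj₂ (adj-sym (proj₁ b→c)))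

      V₁-neighbour? : ∀ v → Decidable λ y → Adj T v y × height y ≡ 1
      V₁-neighbour? v y = adj? v y ×-dec (height y ≟ 1)

      V₁-neighbour : Fin n → Fin n
      V₁-neighbour v = pick (V₁-neighbour? v) v

      V₁-neighbour-spec : ∀ {v} → height v ≡ 0 ⊎ height v ≡ 2 →
        Adj T v (V₁-neighbour v) × height (V₁-neighbour v) ≡ 1
      V₁-neighbour-spec {v} v-0or2 = pick-satisfies (V₁-neighbour? v) v (Sum.[ from-0 , from-2 ] v-0or2)
        where
        from-0 : height v ≡ 0 → ∃ λ y → Adj T v y × height y ≡ 1
        from-0 v-0 = let (y , vy) = leaf-has-neighbour (height≡0⇒leaf v-0) in y , vy , neighbour-of-height-0 v-0 vy
        from-2 : height v ≡ 2 → ∃ λ y → Adj T v y × height y ≡ 1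
        from-2 = lower-neighbour

      Dominates : Fin n → Fin n → Set
      Dominates y u = u ∈ M₁ × Adj T u y × u ≢ b

      dominates? : ∀ y → Decidable (Dominates y)
      dominates? y u = (u ∈? M₁) ×-dec adj? u y ×-dec ¬? (u ≟ᶠ b)

      dominator : Fin n → Fin n
      dominator y = pick (dominates? y) y

      dominator-spec : ∀ {y} → height y ≡ 1 → Dominates y (dominator y)
      dominator-spec {y} y-1 = pick-satisfies (dominates? y) y dominated
        where
        dominated : ∃ (Dominates y)
        dominated with y ≟ᶠ x
        ... | yes refl = a , a∈M₁ , adj-sym xa , a≢b
        ... | no y≢x with proj₁ M₁-minimal y
        ... | u , u∈M₁ , uy =
          u , u∈M₁ , uy , λ u≡b → y≢x (V₁-neighbour-unique (subst (λ w → Adj T w y) u≡b uy) (adj-sym xb) y-1 x-1)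

      dominator-∉V₁ : ∀ {y} → height y ≡ 1 → height (dominator y) ≢ 1
      dominator-∉V₁ y-1 d-1 with neighbour-of-height-suc y-1 (adj-sym (proj₁ (proj₂ (dominator-spec y-1))))
      ... | inj₁ d-0 = contradiction (trans (sym d-0) d-1) λ ()
      ... | inj₂ d-2 = contradiction (trans (sym d-2) d-1) λ ()

      dominator-injective : ∀ {y y′} → height y ≡ 1 → height y′ ≡ 1 → dominator y ≡ dominator y′ → y ≡ y′
      dominator-injective y-1 y′-1 same =
        V₁-neighbour-unique (proj₁ (proj₂ (dominator-spec y-1)))
          (subst (λ u → Adj T u _) (sym same) (proj₁ (proj₂ (dominator-spec y′-1)))) y-1 y′-1

      M₂-element : ∀ {v} → v ∈ M₂ → height v ≢ 1 → height v ≡ 0 ⊎ ∃ λ c → ChildOfV₃ c v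
      M₂-element v∈M₂ v≢1 with ∈-subsetOf⁻ S₂? (M₂⊆S₂ v∈M₂)
      ... | inj₁ (inj₁ v-0) = inj₁ v-0
      ... | inj₁ (inj₂ v-1) = contradiction v-1 v≢1
      ... | inj₂ c→v = inj₂ c→v

      M₂-element-height : ∀ {v} → v ∈ M₂ → height v ≢ 1 → height v ≡ 0 ⊎ height v ≡ 2
      M₂-element-height v∈M₂ v≢1 =
        Sum.map₂ (λ (_ , (c→v , c-3)) → neighbour-of-height-3 c-3 (proj₁ c→v)) (M₂-element v∈M₂ v≢1)

      V₁-neighbour-of-V₂-child : ∀ {c v y} → ChildOfV₃ c v → Adj T v y → height y ≡ 1 → Child v y
      V₁-neighbour-of-V₂-child (c→v , c-3) vy y-1 with neighbour-of-child c→v vy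
      ... | inj₁ y≡c = ⊥-elim (heights-differ y-1 c-3 (λ ()) y≡c)
      ... | inj₂ v→y = v→y

      M₂-V₁-private : ∀ {i j y} → i ∈ M₂ → j ∈ M₂ → height i ≢ 1 → height j ≢ 1 →
        Adj T i y → Adj T j y → height y ≡ 1 → i ≡ j
      M₂-V₁-private i∈M₂ j∈M₂ i≢1 j≢1 iy jy y-1 with M₂-element i∈M₂ i≢1 | M₂-element j∈M₂ j≢1
      ... | inj₁ i-0 | _ = sym (leaf-private M₂-minimal i∈M₂ (height≡0⇒leaf i-0) iy j∈M₂ jy)
      ... | _ | inj₁ j-0 = leaf-private M₂-minimal j∈M₂ (height≡0⇒leaf j-0) jy i∈M₂ iy
      ... | inj₂ (_ , c→i) | inj₂ (_ , c′→j) =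
        parent-unique (V₁-neighbour-of-V₂-child c→i iy y-1) (V₁-neighbour-of-V₂-child c′→j jy y-1)

      V₁-neighbour-of-M₂ : ∀ {v} → v ∈ M₂ → height v ≢ 1 →
        Adj T v (V₁-neighbour v) × height (V₁-neighbour v) ≡ 1
      V₁-neighbour-of-M₂ v∈M₂ v≢1 = V₁-neighbour-spec (M₂-element-height v∈M₂ v≢1)

      -- V₁ lies in every total dominating set; every other vertex of M₂ is sent to the
      -- dominator in M₁ of its V₁-neighbour, which is never b.
      embed : Fin n → Fin n
      embed v with height v ≟ 1
      ... | yes _ = v
      ... | no _ = dominator (V₁-neighbour v)

      embed-∈ : MapsInto embed M₂ M₁
      embed-∈ {v} v∈M₂ with height v ≟ 1
      ... | yes v-1 = let (l , vl , l-0) = lower-neighbour v-1 in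
                      leaf-neighbour-∈ (proj₁ M₁-minimal) (height≡0⇒leaf l-0) (adj-sym vl)
      ... | no v≢1 = proj₁ (dominator-spec (proj₂ (V₁-neighbour-of-M₂ v∈M₂ v≢1)))

      embed-injective : InjectiveOn embed M₂
      embed-injective {i} {j} i∈M₂ j∈M₂ with height i ≟ 1 | height j ≟ 1
      ... | yes _ | yes _ = id
      ... | yes i-1 | no j≢1 = λ i≡d →
        ⊥-elim (dominator-∉V₁ (proj₂ (V₁-neighbour-of-M₂ j∈M₂ j≢1)) (subst (λ z → height z ≡ 1) i≡d i-1))
      ... | no i≢1 | yes j-1 = λ d≡j →
        ⊥-elim (dominator-∉V₁ (proj₂ (V₁-neighbour-of-M₂ i∈M₂ i≢1)) (subst (λ z → height z ≡ 1) (sym d≡j) j-1))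
      ... | no i≢1 | no j≢1 = λ same →
        let (iy , y-1) = V₁-neighbour-of-M₂ i∈M₂ i≢1
            (jy′ , y′-1) = V₁-neighbour-of-M₂ j∈M₂ j≢1
        in M₂-V₁-private i∈M₂ j∈M₂ i≢1 j≢1 iy (subst (Adj T j) (sym (dominator-injective y-1 y′-1 same)) jy′) y-1

      embed-≢b : ∀ {v} → v ∈ M₂ → embed v ≢ b
      embed-≢b {v} v∈M₂ with height v ≟ 1
      ... | yes v-1 = heights-differ v-1 b-2 λ ()
      ... | no v≢1 = proj₂ (proj₂ (dominator-spec (proj₂ (V₁-neighbour-of-M₂ v∈M₂ v≢1))))

      absurd : ⊥
      absurd = <-irrefl (wtd M₂ M₁ M₂-minimal M₁-minimal) (injectiveOn⇒∣p∣<∣q∣ embed embed-∈ embed-injective b∈M₁ embed-≢b)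

    upper-neighbour-unique : ∀ {y a b} → height y ≡ 1 → Adj T y a → Adj T y b → height a ≡ 2 → height b ≡ 2 → a ≡ b
    upper-neighbour-unique {a = a} {b} y-1 ya yb a-2 b-2 with a ≟ᶠ b
    ... | yes a≡b = a≡b
    ... | no a≢b = ⊥-elim (TwoUpperNeighbours.absurd y-1 a-2 b-2 ya yb a≢b)

    High : Fin n → Set
    High v = height v ≡ 3 ⊎ height v ≡ 2

    high? : Decidable High
    high? v = (height v ≟ 3) ⊎-dec (height v ≟ 2)

    low⇒¬high : ∀ {v} → Low v → ¬ High v
    low⇒¬high (inj₁ v-0) (inj₁ v-3) = contradiction (trans (sym v-0) v-3) λ ()
    low⇒¬high (inj₁ v-0) (inj₂ v-2) = contradiction (trans (sym v-0) v-2) λ ()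
    low⇒¬high (inj₂ v-1) (inj₁ v-3) = contradiction (trans (sym v-1) v-3) λ ()
    low⇒¬high (inj₂ v-1) (inj₂ v-2) = contradiction (trans (sym v-1) v-2) λ ()

    high-to-low : ∀ {a w} → High a → Adj T a w → ¬ High w → height a ≡ 2 × height w ≡ 1
    high-to-low (inj₁ a-3) aw ¬w-high = ⊥-elim (¬w-high (inj₂ (neighbour-of-height-3 a-3 aw)))
    high-to-low (inj₂ a-2) aw ¬w-high with neighbour-of-height-suc a-2 aw
    ... | inj₁ w-1 = a-2 , w-1
    ... | inj₂ w-3 = ⊥-elim (¬w-high (inj₁ w-3))

    -- Attached a u: a is the last high vertex a walk passed before u, and the walk can only
    -- climb back to height 2 through a again, by upper-neighbour-unique.
    data Attached (a : Fin n) : Fin n → Set where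
      self     : High a → Attached a a
      via-V₁   : ∀ {u} → height a ≡ 2 → height u ≡ 1 → Adj T u a → Attached a u
      via-leaf : ∀ {u y} → height a ≡ 2 → height u ≡ 0 → Adj T u y → Adj T y a → Attached a u

    high-walk : ∀ {a u v k} → Attached a u → High v → Walk T u v k →
      ∃ λ j → Σ (Walk T a v j) λ W → All High (verts T W)
    high-walk (self a-high) _ [] = 0 , [] , a-high ∷ []
    high-walk (via-V₁ _ u-1 _) v-high [] = ⊥-elim (low⇒¬high (inj₂ u-1) v-high)
    high-walk (via-leaf _ u-0 _ _) v-high [] = ⊥-elim (low⇒¬high (inj₁ u-0) v-high)
    high-walk (self a-high) v-high (_∷_ {w = w} aw W) with high? w
    ... | yes w-high = let (j , W′ , all-high) = high-walk (self w-high) v-high W in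
                       suc j , aw ∷ W′ , a-high ∷ all-high
    ... | no ¬w-high = let (a-2 , w-1) = high-to-low a-high aw ¬w-high in
                       high-walk (via-V₁ a-2 w-1 (adj-sym aw)) v-high W
    high-walk (via-V₁ a-2 u-1 ua) v-high (uw ∷ W) with neighbour-of-height-suc u-1 uw
    ... | inj₁ w-0 = high-walk (via-leaf a-2 w-0 (adj-sym uw) ua) v-high W
    ... | inj₂ w-2 with upper-neighbour-unique u-1 uw ua w-2 a-2
    ... | refl = high-walk (self (inj₂ a-2)) v-high W
    high-walk (via-leaf a-2 u-0 uy ya) v-high (uw ∷ W) with leaf-adj-unique (height≡0⇒leaf u-0) uy uw
    ... | refl = high-walk (via-V₁ a-2 (neighbour-of-height-0 u-0 uy) ya) v-high W

    high-connected : ConnectedOn T High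
    high-connected u v u-high v-high = high-walk (self u-high) v-high (proj₂ (walk-between tree u v))

lemma6p5 : ∀ {n} (T : Graph n) → IsTree T → WellTotallyDominated T →
    Balanced T → TreeHeight T 3 →
    IsTreeOn T (λ v → HasHeight T v 3 ⊎ HasHeight T v 2)
lemma6p5 T tree wtd balanced height-3 = connected , tree-cycle-free tree _
  where
  open GraphProperties T using (tree-cycle-free)
  open BalancedHeight3Tree T tree balanced height-3
  connected : ConnectedOn T (λ v → HasHeight T v 3 ⊎ HasHeight T v 2)
  connected u v u-high v-high =
    let (k , W , all-high) = high-connected wtd u v (Sum.map HasHeight⇒height≡ HasHeight⇒height≡ u-high)
                                                    (Sum.map HasHeight⇒height≡ HasHeight⇒height≡ v-high)
    in k , W , All.map (Sum.map height≡⇒HasHeight height≡⇒HasHeight) all-high
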